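{- For every $n \geq 1$, the degree polynomial of $(\mathsf{Tr}(n),\preccurlyeq)$ is $$\mathrm{d}_{\mathsf{Tr}(n)}(x,y) := \sum_{u \in \mathsf{Tr}(n)} x^{\mathrm{in}(u)} y^{\mathrm{out}(u)} = (x+y)^{n-2}\left(x^2 + (n+1)xy + y^2\right),$$ where $\mathrm{in}(u)$ (resp. $\mathrm{out}(u)$) is the number of elements of $\mathsf{Tr}(n)$ covered by (resp. covering) $u$ (for $n=1$ the right-hand side is understood as $x+y$).
   Context: For $n\ge1$, $\mathsf{Tr}(n)$ is the set of words $u = u_1\cdots u_n$ over $\{0,1,2\}$ with $u_1 \neq 2$ and no indices $i<j$ with $u_i=0$, $u_j=1$, ordered componentwise ($u\preccurlyeq v$ iff $u_i\le v_i$ for all $i$). -}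

module Defs where

open import Data.Nat using (ℕ; zero; suc; _+_; _*_; _^_; _∸_)
open import Data.Fin using (Fin; zero; suc) renaming (_≤_ to _≤ᶠ_; _<_ to _<ᶠ_)
import Data.Fin.Properties as FinP
open import Data.Vec using (Vec; []; _∷_; lookup)
import Data.Vec.Properties as VecP
open import Data.Vec.Relation.Binary.Pointwise.Inductive as PW using (Pointwise)
open import Data.List using (List; []; _∷_; map; concatMap; filter; length)
open import Data.Nat.ListAction using (sum)
open import Data.List.Relation.Unary.Any using (Any; any?)
open import Data.Product using (Σ; ∃; _×_; _,_)
open import Data.Product.Properties using () 
open import Relation.Nullary using (¬_; Dec; yes; no)
open import Relation.Nullary.Decidable using (_×-dec_; ¬?)
open import Relation.Binary.PropositionalEquality using (_≡_; _≢_)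

0F 1F 2F : Fin 3
0F = zero
1F = suc zero
2F = suc (suc zero)

Word : ℕ → Set
Word n = Vec (Fin 3) n

words : (n : ℕ) → List (Word n)
words zero    = [] ∷ []
words (suc n) = concatMap (λ a → map (a ∷_) (words n)) (0F ∷ 1F ∷ 2F ∷ [])

-- u₁ ≠ 2 (vacuous for the empty word, which never occurs since n ≥ 1).
FirstNot2 : ∀ {n} → Word n → Set
FirstNot2 []      = Data.Unit.⊤ where import Data.Unit
FirstNot2 (a ∷ _) = a ≢ 2F

No01 : ∀ {n} → Word n → Set
No01 {n} u = ¬ (∃ λ (i : Fin n) → ∃ λ (j : Fin n) → (i <ᶠ j) × (lookup u i ≡ 0F) × (lookup u j ≡ 1F))

IsTr : ∀ {n} → Word n → Set
IsTr u = FirstNot2 u × No01 u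

firstNot2? : ∀ {n} (u : Word n) → Dec (FirstNot2 u)
firstNot2? []      = yes _
firstNot2? (a ∷ _) = ¬? (a FinP.≟ 2F)

no01? : ∀ {n} (u : Word n) → Dec (No01 u)
no01? u = ¬? (FinP.any? λ i → FinP.any? λ j →
            (i FinP.<? j) ×-dec ((lookup u i FinP.≟ 0F) ×-dec (lookup u j FinP.≟ 1F)))

isTr? : ∀ {n} (u : Word n) → Dec (IsTr u)
isTr? u = firstNot2? u ×-dec no01? u

-- The elements of Tr(n), as a list (each exactly once).
Tr : (n : ℕ) → List (Word n)
Tr n = filter isTr? (words n)

_≼_ : ∀ {n} → Word n → Word n → Set
u ≼ v = Pointwise _≤ᶠ_ u v

_≺_ : ∀ {n} → Word n → Word n → Set
u ≺ v = (u ≼ v) × (u ≢ v)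

≺? : ∀ {n} (u v : Word n) → Dec (u ≺ v)
≺? u v = PW.decidable FinP._≤?_ u v ×-dec ¬? (VecP.≡-dec FinP._≟_ u v)

_⋖_ : ∀ {n} → Word n → Word n → Set
_⋖_ {n} v u = (v ≺ u) × ¬ Any (λ w → (v ≺ w) × (w ≺ u)) (Tr n)

⋖? : ∀ {n} (v u : Word n) → Dec (v ⋖ u)
⋖? {n} v u = ≺? v u ×-dec ¬? (any? (λ w → ≺? v w ×-dec ≺? w u) (Tr n))

inDeg : ∀ {n} → Word n → ℕ
inDeg {n} u = length (filter (λ v → ⋖? v u) (Tr n))

outDeg : ∀ {n} → Word n → ℕ
outDeg {n} u = length (filter (λ v → ⋖? u v) (Tr n))

degPoly : ℕ → ℕ → ℕ → ℕ
degPoly n x y = sum (map (λ u → x ^ inDeg u * y ^ outDeg u) (Tr n))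

rhs : ℕ → ℕ → ℕ → ℕ
rhs zero          x y = 0
rhs (suc zero)    x y = x + y
rhs (suc (suc m)) x y = (x + y) ^ m * (x ^ 2 + (suc (suc m) + 1) * x * y + y ^ 2)

{-# OPTIONS --safe #-}
module Submission where

-- Read a word left to right with three phases: nothing read yet, no 0 read yet, a 0 read.
-- Tr(n) consists of the words in which no 2 is read in the initial phase and no 1 after a 0.
-- A cover v ⋖ u raises a single letter: 0 to 1 if no 0 precedes and no 1 follows it, 1 to 2
-- if it is not the first letter, and 0 to 2 if a 0 precedes it (otherwise raising it to 1
-- gives a word in between). Every cover is of this form: raising the first letter where v
-- and u differ to its value in u gives an element of Tr(n) strictly above v and below u,
-- hence u itself. Since the admissible raises depend only on the phase, both directions and
-- the counts in(u), out(u) follow by induction on words, phase by phase. Summing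
-- x^in(u) y^out(u) by the first letter gives d = y (x+y)^(n-1) + K(n-1): the words over
-- {0,2} after a 0 contribute (x+y)^m, and the words starting with 1 contribute
-- K(m) = x (x+y)^m + m x y (x+y)^(m-1).

open import Defs
open import Data.Bool using (Bool; true; false; _∧_; if_then_else_; T)
open import Data.Empty using (⊥; ⊥-elim)
open import Data.Fin using (Fin; zero; suc) renaming (_≤_ to _≤ᶠ_)
import Data.Fin.Properties as FinP
open import Data.List using (List; []; _∷_; map; filter; length; _++_)
open import Data.List.Membership.Propositional using (_∈_; find; lose)
open import Data.List.Membership.Propositional.Properties
  using (∈-++⁺ˡ; ∈-++⁺ʳ; ∈-map⁺; ∈-filter⁺; ∈-filter⁻)
import Data.List.Properties as ListP
open import Data.List.Relation.Unary.Any using (here)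
open import Data.Nat using (ℕ; zero; suc; _+_; _*_; _^_; _≤_; z≤n; s≤s)
open import Data.Nat.ListAction using (sum)
open import Data.Nat.ListAction.Properties using (sum-++)
open import Data.Nat.Properties
  using ( ≤-refl; +-identityʳ; +-comm; +-assoc; +-suc
        ; *-identityʳ; *-zeroʳ; *-assoc; *-distribˡ-+; *-distribʳ-+; *-commutativeSemigroup)
open import Algebra.Properties.CommutativeSemigroup *-commutativeSemigroup using (interchange; x∙yz≈y∙xz)
open import Data.Nat.Tactic.RingSolver using (solve-∀)
open import Data.Product using (_×_; _,_; proj₁; proj₂)
open import Data.Sum using (_⊎_; inj₁; inj₂; [_,_]′)
import Data.Sum as Sum
open import Data.Unit using (⊤; tt)
open import Data.Vec using ([]; _∷_; lookup)
import Data.Vec.Properties as VecP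
open import Data.Vec.Relation.Binary.Pointwise.Inductive as Pointwise using ([]; _∷_)
open import Function using (_∘_; _⇔_; mk⇔)
open import Relation.Binary using (DecidableEquality)
open import Relation.Binary.PropositionalEquality
open import Relation.Nullary using (Dec; yes; no; does; contradiction)
open import Relation.Nullary.Decidable using (_×-dec_; T?; map′; does-⇔)
open import Relation.Unary using (Pred; Decidable)

⟦_⟧ : Bool → ℕ
⟦ b ⟧ = if b then 1 else 0

module _ {a} {A : Set a} where

  sum-map-++ : ∀ (f : A → ℕ) xs ys → sum (map f (xs ++ ys)) ≡ sum (map f xs) + sum (map f ys)
  sum-map-++ f xs ys = trans (cong sum (ListP.map-++ f xs ys)) (sum-++ (map f xs) (map f ys))

  sum-map-cong : ∀ {f g : A → ℕ} → (∀ x → f x ≡ g x) → ∀ xs → sum (map f xs) ≡ sum (map g xs)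
  sum-map-cong f≗g xs = cong sum (ListP.map-cong f≗g xs)

  sum-map-zero : ∀ xs → sum (map (λ (_ : A) → 0) xs) ≡ 0
  sum-map-zero []       = refl
  sum-map-zero (_ ∷ xs) = sum-map-zero xs

  sum-map-*ˡ : ∀ c (f : A → ℕ) xs → sum (map (λ x → c * f x) xs) ≡ c * sum (map f xs)
  sum-map-*ˡ c f []       = sym (*-zeroʳ c)
  sum-map-*ˡ c f (x ∷ xs) =
    trans (cong (c * f x +_) (sum-map-*ˡ c f xs)) (sym (*-distribˡ-+ c (f x) _))

module _ {a p} {A : Set a} {P : Pred A p} (P? : Decidable P) where

  sum-map-filter : ∀ (f : A → ℕ) xs →
    sum (map f (filter P? xs)) ≡ sum (map (λ x → if does (P? x) then f x else 0) xs)
  sum-map-filter f []       = refl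
  sum-map-filter f (x ∷ xs) with does (P? x)
  ... | true  = cong (f x +_) (sum-map-filter f xs)
  ... | false = sum-map-filter f xs

  length-filter-filter : ∀ {q} {Q : Pred A q} (Q? : Decidable Q) xs →
    length (filter Q? (filter P? xs)) ≡ sum (map (λ x → ⟦ does (P? x ×-dec Q? x) ⟧) xs)
  length-filter-filter Q? []       = refl
  length-filter-filter Q? (x ∷ xs) with does (P? x)
  ... | false = length-filter-filter Q? xs
  ... | true with does (Q? x)
  ...   | true  = cong suc (length-filter-filter Q? xs)
  ...   | false = length-filter-filter Q? xs

if-does-cong : ∀ {a b} {A : Set a} {B : Set b} (a? : Dec A) (b? : Dec B) → (A → B) → (B → A) →
               ∀ {m n} → (A → m ≡ n) → (if does a? then m else 0) ≡ (if does b? then n else 0)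
if-does-cong (yes a) (yes _) _   _   m≡n = m≡n a
if-does-cong (no _)  (no _)  _   _   _   = refl
if-does-cong (yes a) (no ¬b) a→b _   _   = contradiction (a→b a) ¬b
if-does-cong (no ¬a) (yes b) _   b→a _   = contradiction (b→a b) ¬a

scale-if : ∀ b c {m n} → m ≡ c * n → (if b then m else 0) ≡ c * (if b then n else 0)
scale-if true  c m≡cn = m≡cn
scale-if false c _    = sym (*-zeroʳ c)

scale-if-⟦⟧ : ∀ b c (m : ℕ → ℕ) {n} → m 1 ≡ c * n →
              (if b then m ⟦ b ⟧ else 0) ≡ c * (if b then n else 0)
scale-if-⟦⟧ true  c m m1≡cn = m1≡cn
scale-if-⟦⟧ false c m _     = sym (*-zeroʳ c)

pattern c₀ = zero
pattern c₁ = suc zero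
pattern c₂ = suc (suc zero)

_≟ʷ_ : ∀ {n} → DecidableEquality (Word n)
_≟ʷ_ = VecP.≡-dec FinP._≟_

words-complete : ∀ {n} (w : Word n) → w ∈ words n
words-complete []               = here refl
words-complete {suc n} (c₀ ∷ w) = ∈-++⁺ˡ (∈-map⁺ (c₀ ∷_) (words-complete w))
words-complete {suc n} (c₁ ∷ w) =
  ∈-++⁺ʳ (map (c₀ ∷_) (words n)) (∈-++⁺ˡ (∈-map⁺ (c₁ ∷_) (words-complete w)))
words-complete {suc n} (c₂ ∷ w) =
  ∈-++⁺ʳ (map (c₀ ∷_) (words n))
    (∈-++⁺ʳ (map (c₁ ∷_) (words n)) (∈-++⁺ˡ (∈-map⁺ (c₂ ∷_) (words-complete w))))

sumWords : ∀ n → (Word n → ℕ) → ℕ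
sumWords n f = sum (map f (words n))

sumWords-suc : ∀ n (f : Word (suc n) → ℕ) →
  sumWords (suc n) f ≡
  sumWords n (f ∘ (c₀ ∷_)) + (sumWords n (f ∘ (c₁ ∷_)) + sumWords n (f ∘ (c₂ ∷_)))
sumWords-suc n f =
  trans (sum-map-++ f (block c₀) _) (cong₂ _+_ (sum-block c₀)
    (trans (sum-map-++ f (block c₁) _) (cong₂ _+_ (sum-block c₁)
      (trans (sum-map-++ f (block c₂) []) (trans (+-identityʳ _) (sum-block c₂))))))
  where
  block : Fin 3 → List (Word (suc n))
  block c = map (c ∷_) (words n)
  sum-block : ∀ c → sum (map f (block c)) ≡ sumWords n (f ∘ (c ∷_))
  sum-block c = cong sum (sym (ListP.map-∘ (words n)))

sumWords-zero : ∀ n → sumWords n (λ _ → 0) ≡ 0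
sumWords-zero n = sum-map-zero (words n)

sumWords-scale : ∀ n c {f g : Word n → ℕ} → (∀ u → f u ≡ c * g u) → sumWords n f ≡ c * sumWords n g
sumWords-scale n c {g = g} f≗cg = trans (sum-map-cong f≗cg (words n)) (sum-map-*ˡ c g (words n))

sumWords-≟-∧ : ∀ n (g : Word n → Bool) u → sumWords n (λ v → ⟦ does (v ≟ʷ u) ∧ g v ⟧) ≡ ⟦ g u ⟧
sumWords-≟-∧ zero    g []       = +-identityʳ ⟦ g [] ⟧
sumWords-≟-∧ (suc n) g (c₀ ∷ u) = trans (sumWords-suc n _) (trans
  (cong₂ _+_ (sumWords-≟-∧ n _ u) (cong₂ _+_ (sumWords-zero n) (sumWords-zero n))) (+-identityʳ _))
sumWords-≟-∧ (suc n) g (c₁ ∷ u) = trans (sumWords-suc n _) (cong₂ _+_ (sumWords-zero n)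
  (trans (cong₂ _+_ (sumWords-≟-∧ n _ u) (sumWords-zero n)) (+-identityʳ _)))
sumWords-≟-∧ (suc n) g (c₂ ∷ u) = trans (sumWords-suc n _) (cong₂ _+_ (sumWords-zero n)
  (cong₂ _+_ (sumWords-zero n) (sumWords-≟-∧ n _ u)))

sumWords-≟-∧′ : ∀ n (g : Word n → Bool) v → sumWords n (λ u → ⟦ does (v ≟ʷ u) ∧ g u ⟧) ≡ ⟦ g v ⟧
sumWords-≟-∧′ n g v =
  trans (sum-map-cong (λ u → cong (λ b → ⟦ b ∧ g u ⟧) (≟ʷ-sym u)) (words n)) (sumWords-≟-∧ n g v)
  where
  ≟ʷ-sym : ∀ u → does (v ≟ʷ u) ≡ does (u ≟ʷ v)
  ≟ʷ-sym u = does-⇔ (mk⇔ sym sym) (v ≟ʷ u) (u ≟ʷ v)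

-- Tr(n) as the language of an automaton

data Phase : Set where
  initial noZero seenZero : Phase

afterNonzero : Phase → Phase
afterNonzero seenZero = seenZero
afterNonzero _        = noZero

next : Fin 3 → Phase → Phase
next c₀      _ = seenZero
next (suc _) s = afterNonzero s

allowed : Fin 3 → Phase → Bool
allowed c₁ seenZero = false
allowed c₂ initial  = false
allowed _  _        = true

Accepts : ∀ {n} → Phase → Word n → Set
Accepts s []      = ⊤
Accepts s (c ∷ w) = T (allowed c s) × Accepts (next c s) w

accepts? : ∀ {n} s (w : Word n) → Dec (Accepts s w)
accepts? s []      = yes tt
accepts? s (c ∷ w) = T? (allowed c s) ×-dec accepts? (next c s) w

seenZero⇒noZero : ∀ {n} {w : Word n} → Accepts seenZero w → Accepts noZero w
seenZero⇒noZero {w = []}     _        = tt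
seenZero⇒noZero {w = c₀ ∷ w} acc      = acc
seenZero⇒noZero {w = c₂ ∷ w} (_ , acc) = tt , seenZero⇒noZero acc

seenZero⇒afterNonzero : ∀ {n} s {w : Word n} → Accepts seenZero w → Accepts (afterNonzero s) w
seenZero⇒afterNonzero initial      = seenZero⇒noZero
seenZero⇒afterNonzero noZero       = seenZero⇒noZero
seenZero⇒afterNonzero seenZero acc = acc

NoOne : ∀ {n} → Word n → Set
NoOne w = ∀ j → lookup w j ≢ 1F

NoOne⇒No01 : ∀ {n} {w : Word n} → NoOne w → No01 w
NoOne⇒No01 noOne (_ , j , _ , _ , wj≡1) = noOne j wj≡1

No01-∷⁻ : ∀ {n c} {w : Word n} → No01 (c ∷ w) → (c ≡ 0F → NoOne w) × No01 w
No01-∷⁻ no01 = (λ { refl j wj≡1 → no01 (zero , suc j , s≤s z≤n , refl , wj≡1) })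
             , λ (i , j , i<j , wi≡0 , wj≡1) → no01 (suc i , suc j , s≤s i<j , wi≡0 , wj≡1)

No01-∷⁺ : ∀ {n c} {w : Word n} → (c ≡ 0F → NoOne w) → No01 w → No01 (c ∷ w)
No01-∷⁺ noOne _    (zero  , suc j , _       , c≡0  , wj≡1) = noOne c≡0 j wj≡1
No01-∷⁺ _     no01 (suc i , suc j , s≤s i<j , wi≡0 , wj≡1) = no01 (i , j , i<j , wi≡0 , wj≡1)

seenZero⇒NoOne : ∀ {n} (w : Word n) → Accepts seenZero w → NoOne w
seenZero⇒NoOne (c₀ ∷ w) _         zero    = λ ()
seenZero⇒NoOne (c₂ ∷ w) _         zero    = λ ()
seenZero⇒NoOne (c₀ ∷ w) (_ , acc) (suc j) = seenZero⇒NoOne w acc j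
seenZero⇒NoOne (c₂ ∷ w) (_ , acc) (suc j) = seenZero⇒NoOne w acc j

NoOne⇒seenZero : ∀ {n} (w : Word n) → NoOne w → Accepts seenZero w
NoOne⇒seenZero []       _     = tt
NoOne⇒seenZero (c₀ ∷ w) noOne = tt , NoOne⇒seenZero w (noOne ∘ suc)
NoOne⇒seenZero (c₁ ∷ w) noOne = contradiction refl (noOne zero)
NoOne⇒seenZero (c₂ ∷ w) noOne = tt , NoOne⇒seenZero w (noOne ∘ suc)

noZero⇒No01 : ∀ {n} (w : Word n) → Accepts noZero w → No01 w
noZero⇒No01 []       _         (() , _)
noZero⇒No01 (c₀ ∷ w) (_ , acc) = No01-∷⁺ (λ _ → noOne) (NoOne⇒No01 {w = w} noOne)
  where noOne = seenZero⇒NoOne w acc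
noZero⇒No01 (c₁ ∷ w) (_ , acc) = No01-∷⁺ (λ ()) (noZero⇒No01 w acc)
noZero⇒No01 (c₂ ∷ w) (_ , acc) = No01-∷⁺ (λ ()) (noZero⇒No01 w acc)

No01⇒noZero : ∀ {n} (w : Word n) → No01 w → Accepts noZero w
No01⇒noZero []       _    = tt
No01⇒noZero (c₀ ∷ w) no01 = tt , NoOne⇒seenZero w (proj₁ (No01-∷⁻ no01) refl)
No01⇒noZero (c₁ ∷ w) no01 = tt , No01⇒noZero w (proj₂ (No01-∷⁻ no01))
No01⇒noZero (c₂ ∷ w) no01 = tt , No01⇒noZero w (proj₂ (No01-∷⁻ no01))

IsTr⇒initial : ∀ {n} (u : Word n) → IsTr u → Accepts initial u
IsTr⇒initial []       _             = tt
IsTr⇒initial (c₀ ∷ w) (_    , no01) = No01⇒noZero (c₀ ∷ w) no01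
IsTr⇒initial (c₁ ∷ w) (_    , no01) = No01⇒noZero (c₁ ∷ w) no01
IsTr⇒initial (c₂ ∷ w) (u₁≢2 , _)    = contradiction refl u₁≢2

initial⇒IsTr : ∀ {n} (u : Word n) → Accepts initial u → IsTr u
initial⇒IsTr []       _   = tt , λ ()
initial⇒IsTr (c₀ ∷ w) acc = (λ ()) , noZero⇒No01 (c₀ ∷ w) acc
initial⇒IsTr (c₁ ∷ w) acc = (λ ()) , noZero⇒No01 (c₁ ∷ w) acc
initial⇒IsTr (c₂ ∷ w) (() , _)

-- Covers

≼-refl : ∀ {n} {w : Word n} → w ≼ w
≼-refl = Pointwise.refl ≤-refl

≼-antisym : ∀ {n} {v w : Word n} → v ≼ w → w ≼ v → v ≡ w
≼-antisym []          []          = refl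
≼-antisym (p ∷ v≼w) (q ∷ w≼v) = cong₂ _∷_ (FinP.≤-antisym p q) (≼-antisym v≼w w≼v)

∷-≺ : ∀ {n c} {v w : Word n} → v ≺ w → (c ∷ v) ≺ (c ∷ w)
∷-≺ (v≼w , v≢w) = ≤-refl ∷ v≼w , v≢w ∘ VecP.∷-injectiveʳ

_⋖⟨_⟩_ : ∀ {n} → Word n → Phase → Word n → Set
v ⋖⟨ s ⟩ u = v ≺ u × (∀ {w} → Accepts s w → v ≺ w → w ≺ u → ⊥)

-- Raise s v u: u is v with one letter raised, a cover when the preceding letters lead to phase s.
data Raise : ∀ {n} → Phase → Word n → Word n → Set where
  keep    : ∀ {n s c} {v u : Word n} → Raise (next c s) v u → Raise s (c ∷ v) (c ∷ u)
  raise₀₁ : ∀ {n s} {w : Word n} → T (allowed c₁ s) → Accepts seenZero w → Raise s (c₀ ∷ w) (c₁ ∷ w)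
  raise₀₂ : ∀ {n} {w : Word n} → Raise seenZero (c₀ ∷ w) (c₂ ∷ w)
  raise₁₂ : ∀ {n} {w : Word n} → Raise noZero (c₁ ∷ w) (c₂ ∷ w)

Raise⇒≼ : ∀ {n s} {v u : Word n} → Raise s v u → v ≼ u
Raise⇒≼ (keep r)      = ≤-refl ∷ Raise⇒≼ r
Raise⇒≼ (raise₀₁ _ _) = z≤n ∷ ≼-refl
Raise⇒≼ raise₀₂       = z≤n ∷ ≼-refl
Raise⇒≼ raise₁₂       = s≤s z≤n ∷ ≼-refl

Raise-irrefl : ∀ {n s} {v u : Word n} → Raise s v u → v ≢ u
Raise-irrefl (keep r) v≡u = Raise-irrefl r (VecP.∷-injectiveʳ v≡u)

Raise-interval : ∀ {n s} {v u : Word n} → Raise s v u →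
                 ∀ {w} → Accepts s w → v ≼ w → w ≼ u → w ≡ v ⊎ w ≡ u
Raise-interval (keep r) (_ , acc) (c≤d ∷ v≼w) (d≤c ∷ w≼u) with FinP.≤-antisym d≤c c≤d
... | refl = Sum.map (cong (_ ∷_)) (cong (_ ∷_)) (Raise-interval r acc v≼w w≼u)
Raise-interval (raise₀₁ _ _) {c₀ ∷ w} _ (_ ∷ v≼w) (_ ∷ w≼v) = inj₁ (cong (c₀ ∷_) (≼-antisym w≼v v≼w))
Raise-interval (raise₀₁ _ _) {c₁ ∷ w} _ (_ ∷ v≼w) (_ ∷ w≼v) = inj₂ (cong (c₁ ∷_) (≼-antisym w≼v v≼w))
Raise-interval (raise₀₁ _ _) {c₂ ∷ w} _ _         (s≤s () ∷ _)
Raise-interval raise₀₂       {c₀ ∷ w} _ (_ ∷ v≼w) (_ ∷ w≼v) = inj₁ (cong (c₀ ∷_) (≼-antisym w≼v v≼w))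
Raise-interval raise₀₂       {c₁ ∷ w} (() , _)
Raise-interval raise₀₂       {c₂ ∷ w} _ (_ ∷ v≼w) (_ ∷ w≼v) = inj₂ (cong (c₂ ∷_) (≼-antisym w≼v v≼w))
Raise-interval raise₁₂       {c₀ ∷ w} _ (() ∷ _)
Raise-interval raise₁₂       {c₁ ∷ w} _ (_ ∷ v≼w) (_ ∷ w≼v) = inj₁ (cong (c₁ ∷_) (≼-antisym w≼v v≼w))
Raise-interval raise₁₂       {c₂ ∷ w} _ (_ ∷ v≼w) (_ ∷ w≼v) = inj₂ (cong (c₂ ∷_) (≼-antisym w≼v v≼w))

Raise⇒⋖⟨⟩ : ∀ {n s} {v u : Word n} → Raise s v u → v ⋖⟨ s ⟩ u
Raise⇒⋖⟨⟩ r = (Raise⇒≼ r , Raise-irrefl r) , λ acc (v≼w , v≢w) (w≼u , w≢u) →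
  [ v≢w ∘ sym , w≢u ]′ (Raise-interval r acc v≼w w≼u)

Raise⇒lower-accepted : ∀ {n s} {v u : Word n} → Raise s v u → Accepts s u → Accepts s v
Raise⇒lower-accepted (keep r)        (ok , acc) = ok , Raise⇒lower-accepted r acc
Raise⇒lower-accepted (raise₀₁ _ acc) _          = tt , acc
Raise⇒lower-accepted raise₀₂         acc        = acc
Raise⇒lower-accepted raise₁₂         acc        = acc

Raise⇒upper-accepted : ∀ {n s} {v u : Word n} → Raise s v u → Accepts s v → Accepts s u
Raise⇒upper-accepted (keep r)                 (ok , acc) = ok , Raise⇒upper-accepted r acc
Raise⇒upper-accepted (raise₀₁ {s = s} ok acc) _          = ok , seenZero⇒afterNonzero s acc
Raise⇒upper-accepted raise₀₂                  acc        = acc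
Raise⇒upper-accepted raise₁₂                  acc        = acc

⋖⟨⟩-tail : ∀ {n s c} {v u : Word n} → T (allowed c s) → (c ∷ v) ⋖⟨ s ⟩ (c ∷ u) → v ⋖⟨ next c s ⟩ u
⋖⟨⟩-tail ok ((_ ∷ v≼u , v≢u) , gap) =
  (v≼u , v≢u ∘ cong (_ ∷_)) , λ acc v≺w w≺u → gap (ok , acc) (∷-≺ v≺w) (∷-≺ w≺u)

⋖⟨⟩-same-tail : ∀ {n s a b} {v u : Word n} → a ≤ᶠ b → a ≢ b →
                (a ∷ v) ⋖⟨ s ⟩ (b ∷ u) → Accepts s (b ∷ v) → v ≡ u
⋖⟨⟩-same-tail {b = b} {v} {u} a≤b a≢b ((_ ∷ v≼u , _) , gap) acc with (b ∷ v) ≟ʷ (b ∷ u)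
... | yes bv≡bu = VecP.∷-injectiveʳ bv≡bu
... | no  bv≢bu = ⊥-elim (gap acc (a≤b ∷ ≼-refl , a≢b ∘ VecP.∷-injectiveˡ) (≤-refl ∷ v≼u , bv≢bu))

⋖⟨⟩⇒Raise : ∀ {n s} {v u : Word n} → Accepts s v → Accepts s u → v ⋖⟨ s ⟩ u → Raise s v u
⋖⟨⟩⇒Raise {v = []} {[]} _ _ ((_ , []≢[]) , _) = contradiction refl []≢[]
⋖⟨⟩⇒Raise {v = c₀ ∷ _} {c₀ ∷ _} (ok , accv) (_ , accu) cov = keep (⋖⟨⟩⇒Raise accv accu (⋖⟨⟩-tail ok cov))
⋖⟨⟩⇒Raise {v = c₁ ∷ _} {c₁ ∷ _} (ok , accv) (_ , accu) cov = keep (⋖⟨⟩⇒Raise accv accu (⋖⟨⟩-tail ok cov))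
⋖⟨⟩⇒Raise {v = c₂ ∷ _} {c₂ ∷ _} (ok , accv) (_ , accu) cov = keep (⋖⟨⟩⇒Raise accv accu (⋖⟨⟩-tail ok cov))
⋖⟨⟩⇒Raise {s = s} {c₀ ∷ _} {c₁ ∷ _} (_ , accv) (ok , _) cov
  with refl ← ⋖⟨⟩-same-tail z≤n (λ ()) cov (ok , seenZero⇒afterNonzero s accv) = raise₀₁ ok accv
⋖⟨⟩⇒Raise {s = initial}  {c₀ ∷ _} {c₂ ∷ _} _ (() , _)
⋖⟨⟩⇒Raise {s = noZero}   {c₀ ∷ v} {c₂ ∷ _} (_ , accv) _ ((_ ∷ v≼u , _) , gap) =
  ⊥-elim (gap {c₁ ∷ v} (tt , seenZero⇒noZero accv) (z≤n ∷ ≼-refl , λ ()) (s≤s z≤n ∷ v≼u , λ ()))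
⋖⟨⟩⇒Raise {s = seenZero} {c₀ ∷ _} {c₂ ∷ _} (_ , accv) _ cov
  with refl ← ⋖⟨⟩-same-tail z≤n (λ ()) cov (tt , accv) = raise₀₂
⋖⟨⟩⇒Raise {s = initial}  {c₁ ∷ _} {c₂ ∷ _} _ (() , _)
⋖⟨⟩⇒Raise {s = seenZero} {c₁ ∷ _} {c₂ ∷ _} (() , _) _
⋖⟨⟩⇒Raise {s = noZero}   {c₁ ∷ _} {c₂ ∷ _} (_ , accv) _ cov
  with refl ← ⋖⟨⟩-same-tail (s≤s z≤n) (λ ()) cov (tt , accv) = raise₁₂
⋖⟨⟩⇒Raise {v = c₁ ∷ _} {c₀ ∷ _} _ _ ((() ∷ _ , _) , _)
⋖⟨⟩⇒Raise {v = c₂ ∷ _} {c₀ ∷ _} _ _ ((() ∷ _ , _) , _)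
⋖⟨⟩⇒Raise {v = c₂ ∷ _} {c₁ ∷ _} _ _ ((s≤s () ∷ _ , _) , _)

⋖⇒⋖⟨initial⟩ : ∀ {n} {v u : Word n} → v ⋖ u → v ⋖⟨ initial ⟩ u
⋖⇒⋖⟨initial⟩ (v≺u , nothing-between) = v≺u , λ {w} acc v≺w w≺u →
  nothing-between (lose (∈-filter⁺ isTr? (words-complete w) (initial⇒IsTr w acc)) (v≺w , w≺u))

⋖⟨initial⟩⇒⋖ : ∀ {n} {v u : Word n} → v ⋖⟨ initial ⟩ u → v ⋖ u
⋖⟨initial⟩⇒⋖ (v≺u , gap) = v≺u , λ between →
  let w , w∈Tr , v≺w , w≺u = find between
  in  gap (IsTr⇒initial w (proj₂ (∈-filter⁻ isTr? {xs = words _} w∈Tr))) v≺w w≺u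

lower-cover⇔Raise : ∀ {n} {v u : Word n} → IsTr u → (IsTr v × v ⋖ u) ⇔ Raise initial v u
lower-cover⇔Raise {v = v} {u} tru = mk⇔
  (λ (trv , v⋖u) → ⋖⟨⟩⇒Raise (IsTr⇒initial v trv) accu (⋖⇒⋖⟨initial⟩ v⋖u))
  (λ r → initial⇒IsTr v (Raise⇒lower-accepted r accu) , ⋖⟨initial⟩⇒⋖ (Raise⇒⋖⟨⟩ r))
  where accu = IsTr⇒initial u tru

upper-cover⇔Raise : ∀ {n} {v u : Word n} → IsTr v → (IsTr u × v ⋖ u) ⇔ Raise initial v u
upper-cover⇔Raise {v = v} {u} trv = mk⇔
  (λ (tru , v⋖u) → ⋖⟨⟩⇒Raise accv (IsTr⇒initial u tru) (⋖⇒⋖⟨initial⟩ v⋖u))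
  (λ r → initial⇒IsTr u (Raise⇒upper-accepted r accv) , ⋖⟨initial⟩⇒⋖ (Raise⇒⋖⟨⟩ r))
  where accv = IsTr⇒initial v trv

-- Counting covers

is-seenZero? : ∀ s → Dec (s ≡ seenZero)
is-seenZero? initial  = no λ ()
is-seenZero? noZero   = no λ ()
is-seenZero? seenZero = yes refl

is-noZero? : ∀ s → Dec (s ≡ noZero)
is-noZero? initial  = no λ ()
is-noZero? noZero   = yes refl
is-noZero? seenZero = no λ ()

raise? : ∀ {n} s (v u : Word n) → Dec (Raise s v u)
raise? s []       []       = no λ ()
raise? s (c₀ ∷ v) (c₀ ∷ u) = map′ keep (λ { (keep r) → r }) (raise? _ v u)
raise? s (c₁ ∷ v) (c₁ ∷ u) = map′ keep (λ { (keep r) → r }) (raise? _ v u)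
raise? s (c₂ ∷ v) (c₂ ∷ u) = map′ keep (λ { (keep r) → r }) (raise? _ v u)
raise? s (c₀ ∷ v) (c₁ ∷ u) =
  map′ (λ { (refl , ok , acc) → raise₀₁ ok acc }) (λ { (raise₀₁ ok acc) → refl , ok , acc })
       (v ≟ʷ u ×-dec T? (allowed c₁ s) ×-dec accepts? seenZero u)
raise? s (c₀ ∷ v) (c₂ ∷ u) =
  map′ (λ { (refl , refl) → raise₀₂ }) (λ { raise₀₂ → refl , refl }) (v ≟ʷ u ×-dec is-seenZero? s)
raise? s (c₁ ∷ v) (c₂ ∷ u) =
  map′ (λ { (refl , refl) → raise₁₂ }) (λ { raise₁₂ → refl , refl }) (v ≟ʷ u ×-dec is-noZero? s)
raise? s (c₁ ∷ v) (c₀ ∷ u) = no λ ()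
raise? s (c₂ ∷ v) (c₀ ∷ u) = no λ ()
raise? s (c₂ ∷ v) (c₁ ∷ u) = no λ ()

inCount : ∀ {n} → Phase → Word n → ℕ
inCount s []       = 0
inCount s (c₀ ∷ u) = inCount seenZero u
inCount s (c₁ ∷ u) = ⟦ allowed c₁ s ∧ does (accepts? seenZero u) ⟧ + inCount (afterNonzero s) u
inCount s (c₂ ∷ u) = ⟦ does (is-seenZero? s) ⟧ + (⟦ does (is-noZero? s) ⟧ + inCount (afterNonzero s) u)

outCount : ∀ {n} → Phase → Word n → ℕ
outCount s []       = 0
outCount s (c₀ ∷ v) =
  ⟦ allowed c₁ s ∧ does (accepts? seenZero v) ⟧ + (⟦ does (is-seenZero? s) ⟧ + outCount seenZero v)
outCount s (c₁ ∷ v) = ⟦ does (is-noZero? s) ⟧ + outCount (afterNonzero s) v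
outCount s (c₂ ∷ v) = outCount (afterNonzero s) v

sumWords-raise-in : ∀ n s (u : Word n) → sumWords n (λ v → ⟦ does (raise? s v u) ⟧) ≡ inCount s u
sumWords-raise-in zero    s []       = refl
sumWords-raise-in (suc n) s (c₀ ∷ u) = trans (sumWords-suc n _) (trans
  (cong₂ _+_ (sumWords-raise-in n _ u) (cong₂ _+_ (sumWords-zero n) (sumWords-zero n))) (+-identityʳ _))
sumWords-raise-in (suc n) s (c₁ ∷ u) = trans (sumWords-suc n _) (cong₂ _+_ (sumWords-≟-∧ n _ u)
  (trans (cong₂ _+_ (sumWords-raise-in n _ u) (sumWords-zero n)) (+-identityʳ _)))
sumWords-raise-in (suc n) s (c₂ ∷ u) = trans (sumWords-suc n _) (cong₂ _+_ (sumWords-≟-∧ n _ u)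
  (cong₂ _+_ (sumWords-≟-∧ n _ u) (sumWords-raise-in n _ u)))

sumWords-raise-out : ∀ n s (v : Word n) → sumWords n (λ u → ⟦ does (raise? s v u) ⟧) ≡ outCount s v
sumWords-raise-out zero    s []       = refl
sumWords-raise-out (suc n) s (c₀ ∷ v) = trans (sumWords-suc n _) (trans
  (cong₂ _+_ (sumWords-raise-out n _ v) (cong₂ _+_ (sumWords-≟-∧′ n _ v) (sumWords-≟-∧′ n _ v)))
  (trans (+-comm (outCount seenZero v) _) (+-assoc ⟦ allowed c₁ s ∧ does (accepts? seenZero v) ⟧ _ _)))
sumWords-raise-out (suc n) s (c₁ ∷ v) = trans (sumWords-suc n _) (cong₂ _+_ (sumWords-zero n)
  (trans (cong₂ _+_ (sumWords-raise-out n _ v) (sumWords-≟-∧′ n _ v))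
         (+-comm (outCount (afterNonzero s) v) _)))
sumWords-raise-out (suc n) s (c₂ ∷ v) = trans (sumWords-suc n _) (cong₂ _+_ (sumWords-zero n)
  (cong₂ _+_ (sumWords-zero n) (sumWords-raise-out n _ v)))

inDeg≡inCount : ∀ {n} (u : Word n) → IsTr u → inDeg u ≡ inCount initial u
inDeg≡inCount {n} u tru = begin
  inDeg u
    ≡⟨ length-filter-filter isTr? (λ v → ⋖? v u) (words n) ⟩
  sumWords n (λ v → ⟦ does (isTr? v ×-dec ⋖? v u) ⟧)
    ≡⟨ sum-map-cong (cong ⟦_⟧ ∘ lower) (words n) ⟩
  sumWords n (λ v → ⟦ does (raise? initial v u) ⟧)
    ≡⟨ sumWords-raise-in n initial u ⟩
  inCount initial u
    ∎
  where
  open ≡-Reasoning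
  lower : ∀ v → does (isTr? v ×-dec ⋖? v u) ≡ does (raise? initial v u)
  lower v = does-⇔ (lower-cover⇔Raise tru) (isTr? v ×-dec ⋖? v u) (raise? initial v u)

outDeg≡outCount : ∀ {n} (v : Word n) → IsTr v → outDeg v ≡ outCount initial v
outDeg≡outCount {n} v trv = begin
  outDeg v
    ≡⟨ length-filter-filter isTr? (λ u → ⋖? v u) (words n) ⟩
  sumWords n (λ u → ⟦ does (isTr? u ×-dec ⋖? v u) ⟧)
    ≡⟨ sum-map-cong (cong ⟦_⟧ ∘ upper) (words n) ⟩
  sumWords n (λ u → ⟦ does (raise? initial v u) ⟧)
    ≡⟨ sumWords-raise-out n initial v ⟩
  outCount initial v
    ∎
  where
  open ≡-Reasoning
  upper : ∀ u → does (isTr? u ×-dec ⋖? v u) ≡ does (raise? initial v u)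
  upper u = does-⇔ (upper-cover⇔Raise trv) (isTr? u ×-dec ⋖? v u) (raise? initial v u)

-- The degree polynomial

module DegreeSums (x y : ℕ) where

  weight : ∀ {n} → Phase → Word n → ℕ
  weight s u = if does (accepts? s u) then x ^ inCount s u * y ^ outCount s u else 0

  degPoly≡sumWords : ∀ n → degPoly n x y ≡ sumWords n (weight initial)
  degPoly≡sumWords n = trans (sum-map-filter isTr? _ (words n)) (sum-map-cong term (words n))
    where
    term : ∀ u → (if does (isTr? u) then x ^ inDeg u * y ^ outDeg u else 0) ≡ weight initial u
    term u = if-does-cong (isTr? u) (accepts? initial u) (IsTr⇒initial u) (initial⇒IsTr u)
      λ tru → cong₂ (λ i o → x ^ i * y ^ o) (inDeg≡inCount u tru) (outDeg≡outCount u tru)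

  weight-seenZero-c₀ : ∀ {n} (u : Word n) → weight seenZero (c₀ ∷ u) ≡ y * weight seenZero u
  weight-seenZero-c₀ u = scale-if (does (accepts? seenZero u)) y (x∙yz≈y∙xz (x ^ inCount seenZero u) y _)

  weight-seenZero-c₂ : ∀ {n} (u : Word n) → weight seenZero (c₂ ∷ u) ≡ x * weight seenZero u
  weight-seenZero-c₂ u = scale-if (does (accepts? seenZero u)) x (*-assoc x _ _)

  weight-initial-c₀ : ∀ {n} (u : Word n) → weight initial (c₀ ∷ u) ≡ y * weight seenZero u
  weight-initial-c₀ u = scale-if-⟦⟧ (does (accepts? seenZero u)) y
    (λ k → x ^ inCount seenZero u * y ^ (k + outCount seenZero u))
    (x∙yz≈y∙xz (x ^ inCount seenZero u) y _)

  weight-c₁c₀ : ∀ {n} (u : Word n) → weight initial (c₁ ∷ c₀ ∷ u) ≡ x * y * weight seenZero u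
  weight-c₁c₀ u = scale-if-⟦⟧ (does (accepts? seenZero u)) (x * y)
    (λ k → x ^ (k + inCount seenZero u) * y ^ (k + outCount seenZero u)) (interchange x _ y _)

  weight-c₁c₁ : ∀ {n} (u : Word n) → weight initial (c₁ ∷ c₁ ∷ u) ≡ y * weight initial (c₁ ∷ u)
  weight-c₁c₁ u =
    scale-if (does (accepts? noZero u)) y (x∙yz≈y∙xz (x ^ inCount initial (c₁ ∷ u)) y _)

  weight-c₁c₂ : ∀ {n} (u : Word n) → weight initial (c₁ ∷ c₂ ∷ u) ≡ x * weight initial (c₁ ∷ u)
  weight-c₁c₂ u = scale-if (does (accepts? noZero u)) x (trans
    (cong (λ k → x ^ k * y ^ outCount noZero u)
          (+-suc ⟦ does (accepts? seenZero u) ⟧ (inCount noZero u)))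
    (*-assoc x _ _))

  seenZeroSum leadingOneSum : ℕ → ℕ
  seenZeroSum   n = sumWords n (weight seenZero)
  leadingOneSum n = sumWords n (weight initial ∘ (c₁ ∷_))

  degPoly-suc : ∀ n → degPoly (suc n) x y ≡ y * seenZeroSum n + leadingOneSum n
  degPoly-suc n = trans (degPoly≡sumWords (suc n)) (trans (sumWords-suc n _)
    (cong₂ _+_ (sumWords-scale n y weight-initial-c₀)
               (trans (cong (leadingOneSum n +_) (sumWords-zero n)) (+-identityʳ _))))

  seenZeroSum-suc : ∀ n → seenZeroSum (suc n) ≡ y * seenZeroSum n + x * seenZeroSum n
  seenZeroSum-suc n = trans (sumWords-suc n _)
    (cong₂ _+_ (sumWords-scale n y weight-seenZero-c₀)
               (cong₂ _+_ (sumWords-zero n) (sumWords-scale n x weight-seenZero-c₂)))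

  leadingOneSum-suc : ∀ n →
    leadingOneSum (suc n) ≡ x * y * seenZeroSum n + (y * leadingOneSum n + x * leadingOneSum n)
  leadingOneSum-suc n = trans (sumWords-suc n _)
    (cong₂ _+_ (sumWords-scale n (x * y) weight-c₁c₀)
               (cong₂ _+_ (sumWords-scale n y weight-c₁c₁) (sumWords-scale n x weight-c₁c₂)))

  seenZeroSum≡ : ∀ n → seenZeroSum n ≡ (x + y) ^ n
  seenZeroSum≡ zero    = refl
  seenZeroSum≡ (suc n) = trans (seenZeroSum-suc n) (trans (sym (*-distribʳ-+ (seenZeroSum n) y x))
    (cong₂ _*_ (+-comm y x) (seenZeroSum≡ n)))

  leadingOneSum-zero : leadingOneSum 0 ≡ x
  leadingOneSum-zero = trans (+-identityʳ (x * 1 * 1)) (trans (*-identityʳ (x * 1)) (*-identityʳ x))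

  leadingOneSum≡ : ∀ k → leadingOneSum (suc k) ≡ (x + y) ^ k * ((x + y) * x + suc k * x * y)
  leadingOneSum≡ zero = begin
    leadingOneSum 1
      ≡⟨ leadingOneSum-suc 0 ⟩
    x * y * seenZeroSum 0 + (y * leadingOneSum 0 + x * leadingOneSum 0)
      ≡⟨ cong (λ h → x * y * 1 + (y * h + x * h)) leadingOneSum-zero ⟩
    x * y * 1 + (y * x + x * x)
      ≡⟨ identity x y ⟩
    1 * ((x + y) * x + 1 * x * y)
      ∎
    where
    open ≡-Reasoning
    identity : ∀ x y → x * y * 1 + (y * x + x * x) ≡ 1 * ((x + y) * x + 1 * x * y)
    identity = solve-∀
  leadingOneSum≡ (suc k) = begin
    leadingOneSum (suc (suc k))
      ≡⟨ leadingOneSum-suc (suc k) ⟩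
    x * y * seenZeroSum (suc k) + (y * leadingOneSum (suc k) + x * leadingOneSum (suc k))
      ≡⟨ cong₂ (λ g h → x * y * g + (y * h + x * h)) (seenZeroSum≡ (suc k)) (leadingOneSum≡ k) ⟩
    x * y * ((x + y) * p) + (y * (p * q) + x * (p * q))
      ≡⟨ identity x y k p ⟩
    (x + y) * p * ((x + y) * x + suc (suc k) * x * y)
      ∎
    where
    open ≡-Reasoning
    p = (x + y) ^ k
    q = (x + y) * x + suc k * x * y
    identity : ∀ x y k p → x * y * ((x + y) * p) + (y * (p * ((x + y) * x + suc k * x * y))
                                                  + x * (p * ((x + y) * x + suc k * x * y)))
                           ≡ (x + y) * p * ((x + y) * x + suc (suc k) * x * y)
    identity = solve-∀

mainTheorem7 : (n : ℕ) → 1 ≤ n → (x y : ℕ) → degPoly n x y ≡ rhs n x y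
mainTheorem7 (suc zero) _ x y = begin
  degPoly 1 x y                          ≡⟨ degPoly-suc 0 ⟩
  y * seenZeroSum 0 + leadingOneSum 0    ≡⟨ cong (y * 1 +_) leadingOneSum-zero ⟩
  y * 1 + x                              ≡⟨ cong (_+ x) (*-identityʳ y) ⟩
  y + x                                  ≡⟨ +-comm y x ⟩
  x + y                                  ∎
  where open ≡-Reasoning; open DegreeSums x y
mainTheorem7 (suc (suc k)) _ x y = begin
  degPoly (suc (suc k)) x y
    ≡⟨ degPoly-suc (suc k) ⟩
  y * seenZeroSum (suc k) + leadingOneSum (suc k)
    ≡⟨ cong₂ (λ g h → y * g + h) (seenZeroSum≡ (suc k)) (leadingOneSum≡ k) ⟩
  y * ((x + y) * p) + p * ((x + y) * x + suc k * x * y)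
    ≡⟨ identity x y k p ⟩
  p * (x * x + (suc (suc k) + 1) * x * y + y * y)
    ≡⟨ cong₂ (λ a b → p * (a + (suc (suc k) + 1) * x * y + b)) (sym (square x)) (sym (square y)) ⟩
  rhs (suc (suc k)) x y
    ∎
  where
  open ≡-Reasoning
  open DegreeSums x y
  p = (x + y) ^ k
  square : ∀ z → z ^ 2 ≡ z * z
  square z = cong (z *_) (*-identityʳ z)
  identity : ∀ x y k p → y * ((x + y) * p) + p * ((x + y) * x + suc k * x * y)
                         ≡ p * (x * x + (suc (suc k) + 1) * x * y + y * y)
  identity = solve-∀
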